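{- For $n\geq 3$, the number of permutations $\pi\in\mathcal{S}_n$ such that $\pi^2$ has exactly one descent equals \[\sum_{k=2}^{n-1} b_{k}\, e_{n-(k+1)}\,(n-k).\]
   Context: $\mathcal{S}_n$ is the symmetric group on $[n]$; a permutation $\sigma=\sigma_1\cdots\sigma_n$ (one-line notation) has a descent at position $i\in[n-1]$ if $\sigma_i>\sigma_{i+1}$, and the size of this descent is $\sigma_i-\sigma_{i+1}$. $\pi^2(j)=\pi(\pi(j))$. $e_j$ is the number of involutions (permutations $\tau$ with $\tau^2=\mathrm{id}$) in $\mathcal{S}_j$, with $e_0=1$. For $k\geq 1$, $\mathcal{A}_k\subset\mathcal{S}_{k+1}$ is the set of permutations with exactly one descent whose size is $k$, $\mathcal{B}_k=\{\beta\in\mathcal{S}_{k+1}:\beta^2\in\mathcal{A}_k\}$, and $b_k=|\mathcal{B}_k|$. -}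

module Defs where

open import Data.Nat using (ℕ; zero; suc; _+_; _*_; _∸_; _<ᵇ_)
open import Data.Fin using (Fin; toℕ; inject₁) renaming (suc to fsuc; _≟_ to _≟ᶠ_)
open import Data.Vec using (Vec; []; _∷_; lookup; map)
open import Data.List using (List; []; _∷_; length; filter; concatMap; applyUpTo)
open import Data.Nat.ListAction using (sum)
import Data.List as L
open import Data.Fin using (Fin)

open import Data.Bool using (Bool; true; false; if_then_else_)
open import Relation.Nullary using (Dec; ¬?)
open import Relation.Binary.PropositionalEquality using (_≡_)
open import Data.Vec.Relation.Unary.Unique.Propositional using (Unique)
open import Data.Vec.Relation.Unary.AllPairs using (allPairs?)
import Data.Vec.Relation.Unary.All as VAll
open import Data.Vec.Relation.Unary.All using (All)
import Data.Nat as N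

-- A permutation of [n] in one-line notation: σ = σ₁ ⋯ σₙ, stored as a
-- vector of length n with entries in Fin n (value j ∈ Fin n stands for j+1),
-- whose entries are pairwise distinct.
OneLine : ℕ → Set
OneLine n = Vec (Fin n) n

allVecs : (m n : ℕ) → List (Vec (Fin n) m)
allVecs zero    n = [] ∷ []
allVecs (suc m) n = concatMap (λ x → L.map (x ∷_) (allVecs m n)) (L.allFin n)
  where import Data.List as L

IsPerm : ∀ {n} → OneLine n → Set
IsPerm σ = Unique σ

isPerm? : ∀ {n} (σ : OneLine n) → Dec (IsPerm σ)
isPerm? σ = allPairs? (λ x y → ¬? (x ≟ᶠ y)) σ

Sym : (n : ℕ) → List (OneLine n)
Sym n = filter isPerm? (allVecs n n)

_∘ₚ_ : ∀ {n} → OneLine n → OneLine n → OneLine n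
σ ∘ₚ τ = map (lookup σ) τ

square : ∀ {n} → OneLine n → OneLine n
square σ = σ ∘ₚ σ

-- descent positions i (0-based here) with σᵢ > σᵢ₊₁, listed as the list of
-- their sizes σᵢ - σᵢ₊₁
descentSizes : ∀ {m n} → Vec (Fin n) m → List ℕ
descentSizes []           = []
descentSizes (x ∷ [])     = []
descentSizes (x ∷ y ∷ xs) =
  (if toℕ y <ᵇ toℕ x then (toℕ x ∸ toℕ y) ∷ [] else [])
  L.++ descentSizes (y ∷ xs)

numDescents : ∀ {m n} → Vec (Fin n) m → ℕ
numDescents σ = length (descentSizes σ)

IsInvolution : ∀ {n} → OneLine n → Set
IsInvolution σ = square σ ≡ Data.Vec.tabulate (λ j → j)

isInvolution? : ∀ {n} (σ : OneLine n) → Dec (IsInvolution σ)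
isInvolution? σ = Data.Vec.Properties.≡-dec _≟ᶠ_ (square σ) _
  where import Data.Vec.Properties

e : ℕ → ℕ
e j = length (filter isInvolution? (Sym j))

InA : (k : ℕ) → OneLine (suc k) → Set
InA k σ = descentSizes σ ≡ k ∷ []

inA? : (k : ℕ) (σ : OneLine (suc k)) → Dec (InA k σ)
inA? k σ = Data.List.Properties.≡-dec N._≟_ (descentSizes σ) (k ∷ [])
  where import Data.List.Properties

InB : (k : ℕ) → OneLine (suc k) → Set
InB k β = InA k (square β)

b : ℕ → ℕ
b k = length (filter (λ β → inA? k (square β)) (Sym (suc k)))

OneDescentSquare : ∀ {n} → OneLine n → Set
OneDescentSquare π = numDescents (square π) ≡ 1

oneDescentSquare? : ∀ {n} (π : OneLine n) → Dec (OneDescentSquare π)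
oneDescentSquare? π = numDescents (square π) N.≟ 1

countOneDescentSquare : ℕ → ℕ
countOneDescentSquare n = length (filter oneDescentSquare? (Sym n))

sumRange : ℕ → ℕ → (ℕ → ℕ) → ℕ
sumRange lo hi f = sum (applyUpTo (λ i → f (lo + i)) (suc hi ∸ lo))

-- If π² has a single descent, of size k, then π² is the identity outside a block
-- [a, a + k] and moves every point of that block: the values below the descent lie on the
-- first increasing run, those above it on the second.  As π commutes with π², it preserves
-- the block, so π is a permutation β of the block with β² ∈ 𝒜_k glued to an involution ι of
-- the n - k - 1 remaining points; conversely every such triple (a, β, ι) glues to such a π.
-- Hence exactly b_k e_{n-k-1} (n - k) permutations have π² with a single descent of size k,
-- and summing over k gives the formula, the term k = 1 vanishing since b_1 = 0.

{-# OPTIONS --safe #-}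
module Submission where

open import Defs
open import Data.Bool using (true; false; if_then_else_)
open import Data.Fin as Fin using (Fin; toℕ; fromℕ<; punchOut)
open import Data.Fin.Properties
  using (toℕ<n; toℕ-fromℕ<; toℕ-injective; fromℕ<-injective; any?; punchOut-injective; injective⇒≤)
open import Data.List
  using (List; []; _∷_; length; filter; map; applyUpTo; cartesianProduct; cartesianProductWith; allFin; concatMap; _++_)
open import Data.List.Properties
  using ( ≡-dec; length-tabulate; length-map; length-++; ++-assoc; ++-identityʳ; map-applyUpTo
        ; ∷-injectiveˡ; ∷-injectiveʳ)
open import Data.List.Membership.Propositional using (_∈_)
open import Data.List.Membership.Propositional.Properties
  using ( ∈-map⁺; ∈-map⁻; ∈-filter⁺; ∈-filter⁻; ∈-allFin
        ; ∈-cartesianProductWith⁺; ∈-cartesianProduct⁺; ∈-cartesianProduct⁻)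
open import Data.List.Membership.Propositional.Properties.WithK using (unique∧set⇒bag)
open import Data.List.Relation.Binary.BagAndSetEquality using (∼bag⇒↭)
open import Data.List.Relation.Binary.Permutation.Propositional.Properties using (↭-length)
open import Data.List.Relation.Unary.All as All using (All; []; _∷_)
open import Data.List.Relation.Unary.All.Properties using (map⁺; ++⁺; applyUpTo⁺₁)
open import Data.List.Relation.Unary.AllPairs using ([]; _∷_)
open import Data.List.Relation.Unary.Any using (here; there)
open import Data.List.Relation.Unary.Unique.Propositional using (Unique)
import Data.List.Relation.Unary.Unique.Propositional.Properties as Unique
open import Data.Nat
open import Data.Nat.Induction using (<-rec; <-wellFounded)
open import Data.Nat.ListAction using (sum)
open import Data.Nat.Properties
open import Algebra.Properties.CommutativeSemigroup +-commutativeSemigroup using (interchange)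
open import Data.Product using (∃-syntax; _×_; _,_; proj₁; proj₂; uncurry)
open import Data.Sum using (_⊎_; inj₁; inj₂; [_,_]′)
open import Data.Vec as Vec using (Vec; []; _∷_; lookup; tabulate)
open import Data.Vec.Properties using (tabulate∘lookup) renaming (∷-injective to ∷-injectiveᵥ)
open import Data.Vec.Relation.Unary.Unique.Propositional.Properties using (lookup-injective; tabulate⁺)
open import Function using (_∘_)
open import Function.Bundles using (mk⇔)
import Induction.WellFounded as WF
open import Level using (0ℓ)
open import Relation.Binary using (tri<; tri≈; tri>)
import Relation.Binary.Construct.On as On
open import Relation.Binary.PropositionalEquality
open import Relation.Nullary using (Dec; yes; no; ¬_; contradiction)
open import Relation.Nullary.Reflects using (ofʸ; ofⁿ)
open import Relation.Unary using (Pred; Decidable)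

module _ {A B : Set} where

  Unique-map⁺ : (h : A → B) {xs : List A} → Unique xs →
                (∀ {x y} → x ∈ xs → y ∈ xs → h x ≡ h y → x ≡ y) → Unique (map h xs)
  Unique-map⁺ h []               inj = []
  Unique-map⁺ h (x∉xs ∷ xs-uniq) inj =
    map⁺ (All.tabulate λ y∈ → All.lookup x∉xs y∈ ∘ inj (here refl) (there y∈))
      ∷ Unique-map⁺ h xs-uniq (λ x∈ y∈ → inj (there x∈) (there y∈))

  length-filter≡length : {P : Pred B 0ℓ} (P? : Decidable P) (h : A → B) {xs : List A} {ys : List B} →
    Unique xs → Unique ys →
    (∀ {x} → x ∈ xs → h x ∈ ys × P (h x)) →
    (∀ {y} → y ∈ ys → P y → ∃[ x ] x ∈ xs × h x ≡ y) →
    (∀ {x x′} → x ∈ xs → x′ ∈ xs → h x ≡ h x′ → x ≡ x′) →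
    length (filter P? ys) ≡ length xs
  length-filter≡length P? h {xs} {ys} xs-uniq ys-uniq into onto inj = begin
    length (filter P? ys) ≡⟨ ↭-length (∼bag⇒↭ (unique∧set⇒bag
                               (Unique.filter⁺ P? ys-uniq) (Unique-map⁺ h xs-uniq inj) (mk⇔ to from))) ⟩
    length (map h xs)     ≡⟨ length-map h xs ⟩
    length xs             ∎
    where
    open ≡-Reasoning
    to : ∀ {y} → y ∈ filter P? ys → y ∈ map h xs
    to y∈ with y∈ys , Py ← ∈-filter⁻ P? y∈ with x , x∈ , refl ← onto y∈ys Py = ∈-map⁺ h x∈
    from : ∀ {y} → y ∈ map h xs → y ∈ filter P? ys
    from y∈ with x , x∈ , refl ← ∈-map⁻ h y∈ = uncurry (∈-filter⁺ P?) (into x∈)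

length-cartesianProduct : ∀ {A B : Set} (xs : List A) (ys : List B) →
                          length (cartesianProduct xs ys) ≡ length xs * length ys
length-cartesianProduct []       ys = refl
length-cartesianProduct (x ∷ xs) ys = begin
  length (map (x ,_) ys ++ cartesianProduct xs ys)         ≡⟨ length-++ (map (x ,_) ys) ⟩
  length (map (x ,_) ys) + length (cartesianProduct xs ys) ≡⟨ cong₂ _+_ (length-map (x ,_) ys)
                                                                         (length-cartesianProduct xs ys) ⟩
  length ys + length xs * length ys                        ∎
  where open ≡-Reasoning

applyUpTo-cong : ∀ {A : Set} {f g : ℕ → A} m → (∀ {i} → i < m → f i ≡ g i) → applyUpTo f m ≡ applyUpTo g m
applyUpTo-cong zero    _   = refl
applyUpTo-cong (suc m) f≗g = cong₂ _∷_ (f≗g z<s) (applyUpTo-cong m (f≗g ∘ s<s))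

applyUpTo-+ : ∀ {A : Set} (f : ℕ → A) a m → applyUpTo f (a + m) ≡ applyUpTo f a ++ applyUpTo (λ i → f (a + i)) m
applyUpTo-+ f zero    m = refl
applyUpTo-+ f (suc a) m = cong (f 0 ∷_) (applyUpTo-+ (f ∘ suc) a m)

concatMap≡cartesianProductWith : ∀ {A B C : Set} (f : A → B → C) xs ys →
  concatMap (λ x → map (f x) ys) xs ≡ cartesianProductWith f xs ys
concatMap≡cartesianProductWith f []       ys = refl
concatMap≡cartesianProductWith f (x ∷ xs) ys = cong (map (f x) ys ++_) (concatMap≡cartesianProductWith f xs ys)

allVecs-suc : ∀ m n → allVecs (suc m) n ≡ cartesianProductWith _∷_ (allFin n) (allVecs m n)
allVecs-suc m n = concatMap≡cartesianProductWith _∷_ (allFin n) (allVecs m n)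

allVecs-unique : ∀ m n → Unique (allVecs m n)
allVecs-unique zero    n = [] ∷ []
allVecs-unique (suc m) n rewrite allVecs-suc m n =
  Unique.cartesianProductWith⁺ _∷_ ∷-injectiveᵥ (Unique.allFin⁺ n) (allVecs-unique m n)

∈-allVecs : ∀ {m n} (v : Vec (Fin n) m) → v ∈ allVecs m n
∈-allVecs []                  = here refl
∈-allVecs {suc m} {n} (x ∷ v) rewrite allVecs-suc m n =
  ∈-cartesianProductWith⁺ _∷_ (∈-allFin x) (∈-allVecs v)

Sym-unique : ∀ n → Unique (Sym n)
Sym-unique n = Unique.filter⁺ isPerm? (allVecs-unique n n)

∈-Sym⁺ : ∀ {n} {σ : OneLine n} → IsPerm σ → σ ∈ Sym n
∈-Sym⁺ {σ = σ} = ∈-filter⁺ isPerm? (∈-allVecs σ)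

∈-Sym⁻ : ∀ {n} {σ : OneLine n} → σ ∈ Sym n → IsPerm σ
∈-Sym⁻ {n} = proj₂ ∘ ∈-filter⁻ isPerm? {xs = allVecs n n}

record IsPermutation (n : ℕ) (f : ℕ → ℕ) : Set where
  field
    bounded   : ∀ {j} → j < n → f j < n
    injective : ∀ {i j} → i < n → j < n → f i ≡ f j → i ≡ j

IsPermutation-cong : ∀ {n f g} → (∀ {j} → j < n → f j ≡ g j) → IsPermutation n f → IsPermutation n g
IsPermutation-cong {n} f≗g f-perm = record
  { bounded   = λ j<n → subst (_< n) (f≗g j<n) (bounded j<n)
  ; injective = λ i<n j<n eq → injective i<n j<n (trans (f≗g i<n) (trans eq (sym (f≗g j<n))))
  }
  where open IsPermutation f-perm

IsPermutation-∘ : ∀ {n f g} → IsPermutation n f → IsPermutation n g → IsPermutation n (f ∘ g)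
IsPermutation-∘ f-perm g-perm = record
  { bounded   = F.bounded ∘ G.bounded
  ; injective = λ i<n j<n → G.injective i<n j<n ∘ F.injective (G.bounded i<n) (G.bounded j<n)
  }
  where module F = IsPermutation f-perm; module G = IsPermutation g-perm

-- An injective self-map g of Fin n missing a value t would, after punching t out, inject
-- Fin n into Fin (n ∸ 1).
IsPermutation⇒surjective : ∀ {n f} → IsPermutation n f → ∀ {v} → v < n → ∃[ j ] j < n × f j ≡ v
IsPermutation⇒surjective {suc n} {f} f-perm {v} v<n = hit (any? (λ i → g i Fin.≟ t))
  where
  open IsPermutation f-perm
  t : Fin (suc n)
  t = fromℕ< v<n
  g : Fin (suc n) → Fin (suc n)
  g i = fromℕ< (bounded (toℕ<n i))
  g-injective : ∀ {i j} → g i ≡ g j → i ≡ j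
  g-injective {i} {j} = toℕ-injective ∘ injective (toℕ<n i) (toℕ<n j) ∘ fromℕ<-injective _ _ _ _
  hit : Dec (∃[ i ] g i ≡ t) → ∃[ j ] j < suc n × f j ≡ v
  hit (yes (i , gi≡t)) = toℕ i , toℕ<n i , trans (sym (toℕ-fromℕ< _)) (trans (cong toℕ gi≡t) (toℕ-fromℕ< v<n))
  hit (no  t∉g)        = contradiction (injective⇒≤ punched-injective) (<-irrefl refl)
    where
    t≢g : ∀ i → t ≢ g i
    t≢g i = t∉g ∘ (i ,_) ∘ sym
    punched-injective : ∀ {i j} → punchOut (t≢g i) ≡ punchOut (t≢g j) → i ≡ j
    punched-injective {i} {j} = g-injective ∘ punchOut-injective (t≢g i) (t≢g j)

-- The entries of a vector as a function on ℕ, with junk value 0 beyond the length.  The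
-- combinatorics is done on such functions, so that positions are plain naturals.
at : ∀ {m n} → Vec (Fin n) m → ℕ → ℕ
at []      _       = 0
at (x ∷ v) zero    = toℕ x
at (x ∷ v) (suc j) = at v j

at-lookup : ∀ {m n} (v : Vec (Fin n) m) (i : Fin m) → at v (toℕ i) ≡ toℕ (lookup v i)
at-lookup (x ∷ v) Fin.zero    = refl
at-lookup (x ∷ v) (Fin.suc i) = at-lookup v i

at< : ∀ {m n} (v : Vec (Fin n) m) {j} → j < m → at v j < n
at< (x ∷ v) {zero}  _       = toℕ<n x
at< (x ∷ v) {suc j} (s≤s j<m) = at< v j<m

at-ext : ∀ {m n} {v w : Vec (Fin n) m} → (∀ {j} → j < m → at v j ≡ at w j) → v ≡ w
at-ext {v = []}    {[]}    _  = refl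
at-ext {v = x ∷ v} {y ∷ w} eq = cong₂ _∷_ (toℕ-injective (eq z<s)) (at-ext (eq ∘ s<s))

fromFun : ∀ {n} m (f : ℕ → ℕ) → (∀ {j} → j < m → f j < n) → Vec (Fin n) m
fromFun zero    f f< = []
fromFun (suc m) f f< = fromℕ< (f< z<s) ∷ fromFun m (f ∘ suc) (f< ∘ s<s)

at-fromFun : ∀ {n} m f (f< : ∀ {j} → j < m → f j < n) {j} → j < m → at (fromFun m f f<) j ≡ f j
at-fromFun (suc m) f f< {zero}  _         = toℕ-fromℕ< _
at-fromFun (suc m) f f< {suc j} (s≤s j<m) = at-fromFun m (f ∘ suc) (f< ∘ s<s) j<m

at-map-lookup : ∀ {n k m} (π : Vec (Fin n) k) (v : Vec (Fin k) m) {j} → j < m →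
                at (Vec.map (lookup π) v) j ≡ at π (at v j)
at-map-lookup π (x ∷ v) {zero}  _         = sym (at-lookup π x)
at-map-lookup π (x ∷ v) {suc j} (s≤s j<m) = at-map-lookup π v j<m

at-square : ∀ {n} (π : OneLine n) {j} → j < n → at (square π) j ≡ at π (at π j)
at-square π = at-map-lookup π π

at-tabulate : ∀ {m n} (g : Fin m → Fin n) {j} (j<m : j < m) → at (tabulate g) j ≡ toℕ (g (fromℕ< j<m))
at-tabulate {suc m} g {zero}  _         = refl
at-tabulate {suc m} g {suc j} (s≤s j<m) = at-tabulate (g ∘ Fin.suc) j<m

at-identity : ∀ {n} {j} → j < n → at (tabulate {n = n} (λ i → i)) j ≡ j
at-identity j<n = trans (at-tabulate (λ i → i) j<n) (toℕ-fromℕ< j<n)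

IsPerm⇒IsPermutation : ∀ {n} {σ : OneLine n} → IsPerm σ → IsPermutation n (at σ)
IsPerm⇒IsPermutation {σ = σ} σ-perm = record
  { bounded   = at< σ
  ; injective = λ i<n j<n eq → fromℕ<-injective _ _ i<n j<n (lookup-injective σ-perm _ _
                  (toℕ-injective (trans (sym (at-fromℕ< i<n)) (trans eq (at-fromℕ< j<n)))))
  }
  where
  at-fromℕ< : ∀ {j} (j<n : j < _) → at σ j ≡ toℕ (lookup σ (fromℕ< j<n))
  at-fromℕ< j<n = trans (cong (at σ) (sym (toℕ-fromℕ< j<n))) (at-lookup σ _)

IsPermutation⇒IsPerm : ∀ {n} {σ : OneLine n} → IsPermutation n (at σ) → IsPerm σ
IsPermutation⇒IsPerm {σ = σ} σ-perm = subst IsPerm (tabulate∘lookup σ) (tabulate⁺ λ {i} {j} eq →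
  toℕ-injective (injective (toℕ<n i) (toℕ<n j) (trans (at-lookup σ i) (trans (cong toℕ eq) (sym (at-lookup σ j))))))
  where open IsPermutation σ-perm

IsInvolution⇒involutive : ∀ {n} {ι : OneLine n} → IsInvolution ι → ∀ {v} → v < n → at ι (at ι v) ≡ v
IsInvolution⇒involutive {ι = ι} ι² {v} v<n =
  trans (sym (at-square ι v<n)) (trans (cong (λ w → at w v) ι²) (at-identity v<n))

involutive⇒IsInvolution : ∀ {n} {ι : OneLine n} → (∀ {v} → v < n → at ι (at ι v) ≡ v) → IsInvolution ι
involutive⇒IsInvolution {ι = ι} ι-inv =
  at-ext λ v<n → trans (at-square ι v<n) (trans (ι-inv v<n) (sym (at-identity v<n)))

-- Descents

descentAt : ℕ → ℕ → List ℕ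
descentAt x y = if y <ᵇ x then x ∸ y ∷ [] else []

descents : List ℕ → List ℕ
descents []           = []
descents (x ∷ [])     = []
descents (x ∷ y ∷ xs) = descentAt x y ++ descents (y ∷ xs)

descentSizes≡descents : ∀ {m n} (v : Vec (Fin n) m) → descentSizes v ≡ descents (applyUpTo (at v) m)
descentSizes≡descents []          = refl
descentSizes≡descents (x ∷ [])    = refl
descentSizes≡descents (x ∷ y ∷ v) = cong (descentAt (toℕ x) (toℕ y) ++_) (descentSizes≡descents (y ∷ v))

descentAt-≤ : ∀ {x y} → x ≤ y → descentAt x y ≡ []
descentAt-≤ {x} {y} x≤y with y <ᵇ x | <ᵇ-reflects-< y x
... | true  | ofʸ y<x = contradiction x≤y (<⇒≱ y<x)
... | false | _       = refl

descentAt-> : ∀ {x y} → y < x → descentAt x y ≡ x ∸ y ∷ []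
descentAt-> {x} {y} y<x with y <ᵇ x | <ᵇ-reflects-< y x
... | true  | _       = refl
... | false | ofⁿ y≮x = contradiction y<x y≮x

descentAt-bounded : ∀ {n x y} → x < n → All (λ d → 0 < d × d < n) (descentAt x y)
descentAt-bounded {x = x} {y} x<n with y <ᵇ x | <ᵇ-reflects-< y x
... | true  | ofʸ y<x = (m<n⇒0<n∸m y<x , ≤-<-trans (m∸n≤m x y) x<n) ∷ []
... | false | _       = []

descentSizes-bounded : ∀ {m n} (v : Vec (Fin n) m) → All (λ d → 0 < d × d < n) (descentSizes v)
descentSizes-bounded []          = []
descentSizes-bounded (x ∷ [])    = []
descentSizes-bounded (x ∷ y ∷ v) = ++⁺ (descentAt-bounded (toℕ<n x)) (descentSizes-bounded (y ∷ v))

+-cancelˡ-<ᵇ : ∀ a x y → (a + y <ᵇ a + x) ≡ (y <ᵇ x)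
+-cancelˡ-<ᵇ zero    x y = refl
+-cancelˡ-<ᵇ (suc a) x y = +-cancelˡ-<ᵇ a x y

descents-map-+ : ∀ a xs → descents (map (a +_) xs) ≡ descents xs
descents-map-+ a []           = refl
descents-map-+ a (x ∷ [])     = refl
descents-map-+ a (x ∷ y ∷ xs) = cong₂ _++_ descentAt-+ (descents-map-+ a (y ∷ xs))
  where
  descentAt-+ : descentAt (a + x) (a + y) ≡ descentAt x y
  descentAt-+ rewrite +-cancelˡ-<ᵇ a x y | [m+n]∸[m+o]≡n∸o a x y = refl

descents-++ : ∀ {c} xs ys → All (_< c) xs → All (c ≤_) ys → descents (xs ++ ys) ≡ descents xs ++ descents ys
descents-++ []            ys       _             _         = refl
descents-++ (x ∷ [])      []       _             _         = refl
descents-++ (x ∷ [])      (y ∷ ys) (x<c ∷ [])    (c≤y ∷ _) = cong (_++ _) (descentAt-≤ (<⇒≤ (<-≤-trans x<c c≤y)))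
descents-++ (x ∷ x′ ∷ xs) ys       (_ ∷ x′∷xs<c) c≤ys      = begin
  descentAt x x′ ++ descents (x′ ∷ xs ++ ys)            ≡⟨ cong (descentAt x x′ ++_)
                                                             (descents-++ (x′ ∷ xs) ys x′∷xs<c c≤ys) ⟩
  descentAt x x′ ++ (descents (x′ ∷ xs) ++ descents ys) ≡⟨ ++-assoc (descentAt x x′) _ _ ⟨
  (descentAt x x′ ++ descents (x′ ∷ xs)) ++ descents ys ∎
  where open ≡-Reasoning

nondecreasing⇒no-descents : ∀ f m → (∀ {i} → suc i < m → f i ≤ f (suc i)) → descents (applyUpTo f m) ≡ []
nondecreasing⇒no-descents f zero          _   = refl
nondecreasing⇒no-descents f (suc zero)    _   = refl
nondecreasing⇒no-descents f (suc (suc m)) inc =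
  cong₂ _++_ (descentAt-≤ (inc (s<s z<s))) (nondecreasing⇒no-descents (f ∘ suc) (suc m) (inc ∘ s<s))

descents-step : ∀ f m {ds} → descentAt (f 0) (f 1) ≡ ds →
                descents (applyUpTo f (suc (suc m))) ≡ ds ++ descents (applyUpTo (f ∘ suc) (suc m))
descents-step f m = cong (_++ descents (applyUpTo (f ∘ suc) (suc m)))

no-descents⇒nondecreasing : ∀ f m → descents (applyUpTo f m) ≡ [] → ∀ {i} → suc i < m → f i ≤ f (suc i)
no-descents⇒nondecreasing f (suc zero)    _  (s≤s ())
no-descents⇒nondecreasing f (suc (suc m)) eq {i} i+1<m with f 1 <? f 0
... | yes f1<f0 = contradiction (trans (sym (descents-step f m (descentAt-> f1<f0))) eq) λ ()
... | no  f1≮f0 with i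
...   | zero  = ≮⇒≥ f1≮f0
...   | suc i = no-descents⇒nondecreasing (f ∘ suc) (suc m)
                  (trans (sym (descents-step f m (descentAt-≤ (≮⇒≥ f1≮f0)))) eq) (s<s⁻¹ i+1<m)

record SingleDescent (f : ℕ → ℕ) (m k : ℕ) : Set where
  field
    position  : ℕ
    position< : suc position < m
    drop      : f (suc position) + k ≡ f position
    ascending : ∀ {j} → suc j < m → j ≢ position → f j ≤ f (suc j)

SingleDescent-shift : ∀ {f m k} → f 0 ≤ f 1 → SingleDescent (f ∘ suc) m k → SingleDescent f (suc m) k
SingleDescent-shift {f} f0≤f1 D = record
  { position  = suc position
  ; position< = s<s position<
  ; drop      = drop
  ; ascending = λ { {zero} _ _ → f0≤f1
                  ; {suc j} j+2<m j+1≢p+1 → ascending (s<s⁻¹ j+2<m) (j+1≢p+1 ∘ cong suc) }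
  }
  where open SingleDescent D

SingleDescent-here : ∀ {f m k} → f 1 < f 0 → descents (applyUpTo (f ∘ suc) (suc m)) ≡ [] →
                     f 0 ∸ f 1 ≡ k → SingleDescent f (suc (suc m)) k
SingleDescent-here {f} {m} f1<f0 no-descents size = record
  { position  = 0
  ; position< = s<s z<s
  ; drop      = trans (cong (f 1 +_) (sym size)) (m+[n∸m]≡n (<⇒≤ f1<f0))
  ; ascending = λ { {zero} _ 0≢0 → contradiction refl 0≢0
                  ; {suc j} j+2<m _ → no-descents⇒nondecreasing (f ∘ suc) (suc m) no-descents (s<s⁻¹ j+2<m) }
  }

descents≡[k]⇒SingleDescent : ∀ f m {k} → descents (applyUpTo f m) ≡ k ∷ [] → SingleDescent f m k
descents≡[k]⇒SingleDescent f (suc (suc m)) {k} eq = step (f 1 <? f 0) (descents≡[k]⇒SingleDescent (f ∘ suc) (suc m))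
  where
  -- The recursive call is made here rather than under a with, where the termination checker
  -- would no longer see that m decreases.
  step : Dec (f 1 < f 0) → (descents (applyUpTo (f ∘ suc) (suc m)) ≡ k ∷ [] → SingleDescent (f ∘ suc) (suc m) k) →
         SingleDescent f (suc (suc m)) k
  step (yes f1<f0) _  = SingleDescent-here f1<f0 (∷-injectiveʳ eq′) (∷-injectiveˡ eq′)
    where
    eq′ : f 0 ∸ f 1 ∷ descents (applyUpTo (f ∘ suc) (suc m)) ≡ k ∷ []
    eq′ = trans (sym (descents-step f m (descentAt-> f1<f0))) eq
  step (no  f1≮f0) ih =
    SingleDescent-shift (≮⇒≥ f1≮f0) (ih (trans (sym (descents-step f m (descentAt-≤ (≮⇒≥ f1≮f0)))) eq))

-- Blocks

module Block (K : ℕ) where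

  Inside : ℕ → ℕ → Set
  Inside a j = a ≤ j × j < a + K

  Outside : ℕ → ℕ → Set
  Outside a j = j < a ⊎ a + K ≤ j

  inside-or-outside : ∀ a j → Inside a j ⊎ Outside a j
  inside-or-outside a j with a ≤? j | j <? a + K
  ... | yes a≤j | yes j<a+K = inj₁ (a≤j , j<a+K)
  ... | yes _   | no  j≮a+K = inj₂ (inj₂ (≮⇒≥ j≮a+K))
  ... | no  a≰j | _         = inj₂ (inj₁ (≰⇒> a≰j))

  inside⇒¬outside : ∀ {a j} → Inside a j → ¬ Outside a j
  inside⇒¬outside (a≤j , _)     (inj₁ j<a)   = <⇒≱ j<a a≤j
  inside⇒¬outside (_ , j<a+K) (inj₂ a+K≤j) = <⇒≱ j<a+K a+K≤j

  +-inside : ∀ a {i} → i < K → Inside a (a + i)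
  +-inside a {i} i<K = m≤m+n a i , +-monoʳ-< a i<K

  inside-∸ : ∀ {a j} → Inside a j → j ∸ a < K
  inside-∸ {a} {j} (a≤j , j<a+K) = subst (j ∸ a <_) (m+n∸m≡n a K) (∸-monoˡ-< j<a+K a≤j)

  -- collapse a renumbers the points of [0, n) outside the block [a, a + K) as 0, …, n ∸ K ∸ 1
  -- (its values on the block are junk); expand a is its inverse.
  collapse : ℕ → ℕ → ℕ
  collapse a j with j <? a
  ... | yes _ = j
  ... | no  _ = j ∸ K

  expand : ℕ → ℕ → ℕ
  expand a v with v <? a
  ... | yes _ = v
  ... | no  _ = v + K

  collapse-< : ∀ {a j} → j < a → collapse a j ≡ j
  collapse-< {a} {j} j<a with j <? a
  ... | yes _   = refl
  ... | no  j≮a = contradiction j<a j≮a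

  collapse-≥ : ∀ {a j} → a ≤ j → collapse a j ≡ j ∸ K
  collapse-≥ {a} {j} a≤j with j <? a
  ... | yes j<a = contradiction a≤j (<⇒≱ j<a)
  ... | no  _   = refl

  expand-< : ∀ {a v} → v < a → expand a v ≡ v
  expand-< {a} {v} v<a with v <? a
  ... | yes _   = refl
  ... | no  v≮a = contradiction v<a v≮a

  expand-≥ : ∀ {a v} → a ≤ v → expand a v ≡ v + K
  expand-≥ {a} {v} a≤v with v <? a
  ... | yes v<a = contradiction a≤v (<⇒≱ v<a)
  ... | no  _   = refl

  expand-outside : ∀ a v → Outside a (expand a v)
  expand-outside a v with v <? a
  ... | yes v<a = inj₁ v<a
  ... | no  v≮a = inj₂ (+-monoˡ-≤ K (≮⇒≥ v≮a))

  collapse-expand : ∀ a v → collapse a (expand a v) ≡ v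
  collapse-expand a v with v <? a
  ... | yes v<a = collapse-< v<a
  ... | no  v≮a = trans (collapse-≥ (≤-trans (≮⇒≥ v≮a) (m≤m+n v K))) (m+n∸n≡m v K)

  expand-collapse : ∀ {a j} → Outside a j → expand a (collapse a j) ≡ j
  expand-collapse {a} (inj₁ j<a) = trans (cong (expand a) (collapse-< j<a)) (expand-< j<a)
  expand-collapse {a} (inj₂ a+K≤j) = begin
    expand a (collapse a _) ≡⟨ cong (expand a) (collapse-≥ (m+n≤o⇒m≤o a a+K≤j)) ⟩
    expand a (_ ∸ K)        ≡⟨ expand-≥ (m+n≤o⇒m≤o∸n a a+K≤j) ⟩
    _ ∸ K + K               ≡⟨ m∸n+n≡m (m+n≤o⇒n≤o a a+K≤j) ⟩
    _                       ∎
    where open ≡-Reasoning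

  expand-injective : ∀ a {u v} → expand a u ≡ expand a v → u ≡ v
  expand-injective a {u} {v} eq = trans (sym (collapse-expand a u)) (trans (cong (collapse a) eq) (collapse-expand a v))

  expand< : ∀ {n} a {v} → K ≤ n → v < n ∸ K → expand a v < n
  expand< a {v} K≤n v<n∸K with v <? a
  ... | yes _ = <-≤-trans v<n∸K (m∸n≤m _ K)
  ... | no  _ = m≤o∸n⇒m+n≤o (suc v) K≤n v<n∸K

  collapse< : ∀ {n a j} → a + K ≤ n → j < n → Outside a j → collapse a j < n ∸ K
  collapse< a+K≤n j<n (inj₁ j<a)   = subst (_< _) (sym (collapse-< j<a)) (<-≤-trans j<a (m+n≤o⇒m≤o∸n _ a+K≤n))
  collapse< {a = a} a+K≤n j<n (inj₂ a+K≤j) =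
    subst (_< _) (sym (collapse-≥ (m+n≤o⇒m≤o a a+K≤j))) (∸-monoˡ-< j<n (m+n≤o⇒n≤o a a+K≤j))

  glue : ℕ → (ℕ → ℕ) → (ℕ → ℕ) → ℕ → ℕ
  glue a B I j with inside-or-outside a j
  ... | inj₁ _ = a + B (j ∸ a)
  ... | inj₂ _ = expand a (I (collapse a j))

  glue-inside : ∀ {a B I j} → Inside a j → glue a B I j ≡ a + B (j ∸ a)
  glue-inside {a} {j = j} j∈ with inside-or-outside a j
  ... | inj₁ _  = refl
  ... | inj₂ j∉ = contradiction j∉ (inside⇒¬outside j∈)

  glue-outside : ∀ {a B I j} → Outside a j → glue a B I j ≡ expand a (I (collapse a j))
  glue-outside {a} {j = j} j∉ with inside-or-outside a j
  ... | inj₁ j∈ = contradiction j∉ (inside⇒¬outside j∈)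
  ... | inj₂ _  = refl

  glue-+ : ∀ a B I {i} → i < K → glue a B I (a + i) ≡ a + B i
  glue-+ a B I {i} i<K = trans (glue-inside (+-inside a i<K)) (cong (λ r → a + B r) (m+n∸m≡n a i))

  glue-expand : ∀ a B I v → glue a B I (expand a v) ≡ expand a (I v)
  glue-expand a B I v = trans (glue-outside (expand-outside a v)) (cong (expand a ∘ I) (collapse-expand a v))

  module _ {n a} (a+K≤n : a + K ≤ n) where

    glue-bounded : ∀ {B I} → (∀ {i} → i < K → B i < K) → (∀ {v} → v < n ∸ K → I v < n ∸ K) →
                   ∀ {j} → j < n → glue a B I j < n
    glue-bounded {B} {I} B< I< {j} j<n = [ on-inside , on-outside ]′ (inside-or-outside a j)
      where
      on-inside : Inside a j → glue a B I j < n
      on-inside j∈ = subst (_< n) (sym (glue-inside j∈)) (<-≤-trans (+-monoʳ-< a (B< (inside-∸ j∈))) a+K≤n)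
      on-outside : Outside a j → glue a B I j < n
      on-outside j∉ = subst (_< n) (sym (glue-outside j∉))
                        (expand< a (m+n≤o⇒n≤o a a+K≤n) (I< (collapse< a+K≤n j<n j∉)))

    glue-cong : ∀ {B B′ I I′} → (∀ {i} → i < K → B i ≡ B′ i) → (∀ {v} → v < n ∸ K → I v ≡ I′ v) →
                ∀ {j} → j < n → glue a B I j ≡ glue a B′ I′ j
    glue-cong {B} {B′} {I} {I′} B≗B′ I≗I′ {j} j<n = [ on-inside , on-outside ]′ (inside-or-outside a j)
      where
      on-inside : Inside a j → glue a B I j ≡ glue a B′ I′ j
      on-inside j∈ = trans (glue-inside j∈) (trans (cong (a +_) (B≗B′ (inside-∸ j∈))) (sym (glue-inside j∈)))
      on-outside : Outside a j → glue a B I j ≡ glue a B′ I′ j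
      on-outside j∉ = trans (glue-outside j∉)
                        (trans (cong (expand a) (I≗I′ (collapse< a+K≤n j<n j∉))) (sym (glue-outside j∉)))

-- Permutations with a single descent

StrictlyIncreasingOn : (ℕ → ℕ) → ℕ → ℕ → Set
StrictlyIncreasingOn f lo hi = ∀ {j} → lo ≤ j → suc j < hi → f j < f (suc j)

module _ {f lo hi} (inc : StrictlyIncreasingOn f lo hi) where

  increasing-spread : ∀ {p q} → lo ≤ p → p ≤ q → q < hi → f p + (q ∸ p) ≤ f q
  increasing-spread {p} {q} lo≤p p≤q q<hi = subst (λ r → f p + (q ∸ p) ≤ f r) (m+[n∸m]≡n p≤q)
    (spread (q ∸ p) (subst (_< hi) (sym (m+[n∸m]≡n p≤q)) q<hi))
    where
    spread : ∀ d → p + d < hi → f p + d ≤ f (p + d)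
    spread zero    _         rewrite +-identityʳ (f p) | +-identityʳ p = ≤-refl
    spread (suc d) p+d+1<hi rewrite +-suc (f p) d | +-suc p d =
      ≤-<-trans (spread d (<-trans (n<1+n _) p+d+1<hi)) (inc (≤-trans lo≤p (m≤m+n p d)) p+d+1<hi)

  increasing-mono-≤ : ∀ {p q} → lo ≤ p → p ≤ q → q < hi → f p ≤ f q
  increasing-mono-≤ {p} {q} lo≤p p≤q q<hi = ≤-trans (m≤m+n (f p) (q ∸ p)) (increasing-spread lo≤p p≤q q<hi)

  increasing-mono-< : ∀ {p q} → lo ≤ p → p < q → q < hi → f p < f q
  increasing-mono-< {p} {q} lo≤p p<q q<hi =
    <-≤-trans (m<m+n (f p) (m<n⇒0<n∸m p<q)) (increasing-spread lo≤p (<⇒≤ p<q) q<hi)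

record BlockShape (n K : ℕ) (f : ℕ → ℕ) : Set where
  field
    start         : ℕ
    start+K≤n     : start + K ≤ n
    fixed-outside : ∀ {j} → j < n → Block.Outside K start j → f j ≡ j
    moved-inside  : ∀ {j} → Block.Inside K start j → f j ≢ j

BlockShape-start-unique : ∀ {n k f a} (S : BlockShape n (suc k) f) →
  (∀ {j} → j < n → Block.Outside (suc k) a j → f j ≡ j) → BlockShape.start S ≡ a
BlockShape-start-unique {n} {k} {f} {a} S fixed-outside-a with <-cmp (BlockShape.start S) a
... | tri≈ _ s≡a _ = s≡a
... | tri< s<a _ _ = contradiction (fixed-outside-a (<-≤-trans (m<m+n s z<s) start+K≤n) (inj₁ s<a))
                                   (moved-inside (≤-refl , m<m+n s z<s))
  where open BlockShape S renaming (start to s)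
... | tri> _ _ a<s = contradiction (fixed-outside-a (<-≤-trans last<s+K start+K≤n) (inj₂ a+K≤last))
                                   (moved-inside (m≤m+n s k , last<s+K))
  where
  open BlockShape S renaming (start to s)
  last<s+K : s + k < s + suc k
  last<s+K = +-monoʳ-< s (n<1+n k)
  a+K≤last : a + suc k ≤ s + k
  a+K≤last = subst (_≤ s + k) (sym (+-suc a k)) (+-monoˡ-≤ k a<s)

module _ {n k f} (f-perm : IsPermutation n f) (D : SingleDescent f n k) where
  open IsPermutation f-perm
  open SingleDescent D renaming (position to i; position< to i+1<n)

  private
    x y : ℕ
    x = f i
    y = f (suc i)

    i<n : i < n
    i<n = <-trans (n<1+n i) i+1<n

    x<n : x < n
    x<n = bounded i<n

    y<n : y < n
    y<n = bounded i+1<n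

    strictly-ascending : ∀ {j} → suc j < n → j ≢ i → f j < f (suc j)
    strictly-ascending j+1<n j≢i = ≤∧≢⇒< (ascending j+1<n j≢i)
      (1+n≢n ∘ sym ∘ injective (<-trans (n<1+n _) j+1<n) j+1<n)

    run₁ : StrictlyIncreasingOn f 0 (suc i)
    run₁ _ j+1<i+1 = strictly-ascending (<-trans j+1<i+1 i+1<n) (<⇒≢ (s<s⁻¹ j+1<i+1))

    run₂ : StrictlyIncreasingOn f (suc i) n
    run₂ i<j j+1<n = strictly-ascending j+1<n (>⇒≢ i<j)

    -- A value j < y is not taken on the second run, so by surjectivity f p = j for some p in
    -- the first run; p < j and p > j are both excluded by the induction hypothesis.
    fixed-below : ∀ {j} → j < y → f j ≡ j
    fixed-below {j} = <-rec (λ j → j < y → f j ≡ j) step j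
      where
      step : ∀ j → (∀ {j′} → j′ < j → j′ < y → f j′ ≡ j′) → j < y → f j ≡ j
      step j rec j<y with IsPermutation⇒surjective f-perm (<-trans j<y y<n)
      ... | p , p<n , fp≡j with <-cmp p j
      ...   | tri≈ _ refl _ = fp≡j
      ...   | tri< p<j _ _ = contradiction (trans (sym (rec p<j (<-trans p<j j<y))) fp≡j) (<⇒≢ p<j)
      ...   | tri> _ _ j<p with p ≤? i
      ...     | no  p≰i =
        contradiction (subst (y ≤_) fp≡j (increasing-mono-≤ run₂ ≤-refl (≰⇒> p≰i) p<n)) (<⇒≱ j<y)
      ...     | yes p≤i = contradiction (injective (bounded j<n) j<n (rec fj<j (<-trans fj<j j<y))) (<⇒≢ fj<j)
        where
        j<n : j < n
        j<n = <-trans j<y y<n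
        fj<j : f j < j
        fj<j = subst (f j <_) fp≡j (increasing-mono-< run₁ z≤n j<p (s≤s p≤i))

    fixed-above : ∀ {j} → x < j → j < n → f j ≡ j
    fixed-above {j} = WF.All.wfRec (On.wellFounded (n ∸_) <-wellFounded) 0ℓ (λ j → x < j → j < n → f j ≡ j) step j
      where
      step : ∀ j → (∀ {j′} → n ∸ j′ < n ∸ j → x < j′ → j′ < n → f j′ ≡ j′) → x < j → j < n → f j ≡ j
      step j rec x<j j<n with IsPermutation⇒surjective f-perm j<n
      ... | p , p<n , fp≡j with <-cmp p j
      ...   | tri≈ _ refl _ = fp≡j
      ...   | tri> _ _ j<p =
        contradiction (trans (sym fp≡j) (rec (∸-monoʳ-< j<p (<⇒≤ p<n)) (<-trans x<j j<p) p<n)) (<⇒≢ j<p)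
      ...   | tri< p<j _ _ with p ≤? i
      ...     | yes p≤i =
        contradiction (subst (_≤ x) fp≡j (increasing-mono-≤ run₁ z≤n p≤i (n<1+n i))) (<⇒≱ x<j)
      ...     | no  p≰i =
        contradiction (injective fj<n j<n (rec (∸-monoʳ-< j<fj (<⇒≤ fj<n)) (<-trans x<j j<fj) fj<n)) (>⇒≢ j<fj)
        where
        fj<n : f j < n
        fj<n = bounded j<n
        j<fj : j < f j
        j<fj = subst (_< f j) fp≡j (increasing-mono-< run₂ (≰⇒> p≰i) p<j j<n)

    -- A fixed point y ≤ j ≤ i would force f y = y = f (i + 1) by spreading along the first
    -- run; symmetrically a fixed point i < j ≤ x would force f x = x = f i.
    moved-between : ∀ {j} → y ≤ j → j ≤ x → f j ≢ j
    moved-between {j} y≤j j≤x fj≡j with j ≤? i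
    ... | yes j≤i = contradiction (injective y<n i+1<n fy≡y) (<⇒≢ (s≤s (≤-trans y≤j j≤i)))
      where
      fy≤y : f y ≤ y
      fy≤y = +-cancelʳ-≤ (j ∸ y) (f y) y (begin
        f y + (j ∸ y) ≤⟨ increasing-spread run₁ z≤n y≤j (s≤s j≤i) ⟩
        f j           ≡⟨ fj≡j ⟩
        j             ≡⟨ m+[n∸m]≡n y≤j ⟨
        y + (j ∸ y)   ∎)
        where open ≤-Reasoning
      fy≡y : f y ≡ y
      fy≡y with m≤n⇒m<n∨m≡n fy≤y
      ... | inj₁ fy<y = contradiction (injective (bounded y<n) y<n (fixed-below fy<y)) (<⇒≢ fy<y)
      ... | inj₂ fy≡y = fy≡y
    ... | no j≰i = contradiction (injective x<n i<n (sym x≡fx)) (>⇒≢ (<-≤-trans (≰⇒> j≰i) j≤x))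
      where
      x≤fx : x ≤ f x
      x≤fx = begin
        x             ≡⟨ m+[n∸m]≡n j≤x ⟨
        j + (x ∸ j)   ≡⟨ cong (_+ (x ∸ j)) fj≡j ⟨
        f j + (x ∸ j) ≤⟨ increasing-spread run₂ (≰⇒> j≰i) j≤x x<n ⟩
        f x           ∎
        where open ≤-Reasoning
      x≡fx : x ≡ f x
      x≡fx with m≤n⇒m<n∨m≡n x≤fx
      ... | inj₁ x<fx = contradiction (injective (bounded x<n) x<n (fixed-above x<fx (bounded x<n))) (>⇒≢ x<fx)
      ... | inj₂ x≡fx = x≡fx

    y+K≡1+x : y + suc k ≡ suc x
    y+K≡1+x = trans (+-suc y k) (cong suc drop)

    outside-fixed : ∀ {j} → j < n → Block.Outside (suc k) y j → f j ≡ j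
    outside-fixed _       (inj₁ j<y)   = fixed-below j<y
    outside-fixed {j} j<n (inj₂ y+K≤j) = fixed-above (subst (_≤ j) y+K≡1+x y+K≤j) j<n

    inside-moved : ∀ {j} → Block.Inside (suc k) y j → f j ≢ j
    inside-moved {j} (y≤j , j<y+K) = moved-between y≤j (s≤s⁻¹ (subst (j <_) y+K≡1+x j<y+K))

  singleDescent⇒BlockShape : BlockShape n (suc k) f
  singleDescent⇒BlockShape = record
    { start         = y
    ; start+K≤n     = subst (_≤ n) (sym y+K≡1+x) x<n
    ; fixed-outside = outside-fixed
    ; moved-inside  = inside-moved
    }

descents-translation : ∀ f c m → (∀ {i} → i < m → f i ≡ c + i) → descents (applyUpTo f m) ≡ []
descents-translation f c m f≡c+ = nondecreasing⇒no-descents f m λ {i} i+1<m →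
  subst₂ _≤_ (sym (f≡c+ (<-trans (n<1+n i) i+1<m))) (sym (f≡c+ i+1<m)) (+-monoʳ-≤ c (n≤1+n i))

descents-sandwich : ∀ {a c} xs ys zs → a ≤ c →
  All (_< a) xs → All (λ y → a ≤ y × y < c) ys → All (c ≤_) zs →
  descents xs ≡ [] → descents zs ≡ [] → descents (xs ++ ys ++ zs) ≡ descents ys
descents-sandwich xs ys zs a≤c xs<a ys∈ c≤zs xs-none zs-none = begin
  descents (xs ++ ys ++ zs)                 ≡⟨ descents-++ xs _ xs<a
                                                 (++⁺ (All.map proj₁ ys∈) (All.map (≤-trans a≤c) c≤zs)) ⟩
  descents xs ++ descents (ys ++ zs)        ≡⟨ cong (descents xs ++_) (descents-++ ys zs (All.map proj₂ ys∈) c≤zs) ⟩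
  descents xs ++ descents ys ++ descents zs ≡⟨ cong₂ (λ u v → u ++ descents ys ++ v) xs-none zs-none ⟩
  descents ys ++ []                         ≡⟨ ++-identityʳ _ ⟩
  descents ys                               ∎
  where open ≡-Reasoning

descents-block : ∀ {K n a} (f : ℕ → ℕ) → a + K ≤ n →
  (∀ {j} → j < n → Block.Outside K a j → f j ≡ j) → (∀ {i} → i < K → Block.Inside K a (f (a + i))) →
  descents (applyUpTo f n) ≡ descents (applyUpTo (λ i → f (a + i) ∸ a) K)
descents-block {K} {n} {a} f a+K≤n fixed inside = begin
  descents (applyUpTo f n)                     ≡⟨ cong (descents ∘ applyUpTo f) a+[K+r]≡n ⟨
  descents (applyUpTo f (a + (K + r)))         ≡⟨ cong descents split ⟩
  descents (before ++ block ++ after)          ≡⟨ descents-sandwich before block after (m≤m+n a K) before<a block∈ a+K≤after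
                                                    (descents-translation f 0 a fixed-before)
                                                    (descents-translation _ (a + K) r fixed-after) ⟩
  descents block                               ≡⟨ cong descents block≡ ⟩
  descents (map (a +_) relative)               ≡⟨ descents-map-+ a relative ⟩
  descents relative                            ∎
  where
  open ≡-Reasoning
  r : ℕ
  r = n ∸ (a + K)
  a+[K+r]≡n : a + (K + r) ≡ n
  a+[K+r]≡n = trans (sym (+-assoc a K r)) (m+[n∸m]≡n a+K≤n)
  before block after relative : List ℕ
  before   = applyUpTo f a
  block    = applyUpTo (λ i → f (a + i)) K
  after    = applyUpTo (λ i → f (a + (K + i))) r
  relative = applyUpTo (λ i → f (a + i) ∸ a) K
  split : applyUpTo f (a + (K + r)) ≡ before ++ block ++ after
  split = trans (applyUpTo-+ f a (K + r)) (cong (before ++_) (applyUpTo-+ (λ i → f (a + i)) K r))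
  fixed-before : ∀ {i} → i < a → f i ≡ i
  fixed-before i<a = fixed (<-≤-trans i<a (m+n≤o⇒m≤o a a+K≤n)) (inj₁ i<a)
  fixed-after : ∀ {i} → i < r → f (a + (K + i)) ≡ a + K + i
  fixed-after {i} i<r = trans (fixed a+[K+i]<n (inj₂ (subst (a + K ≤_) (+-assoc a K i) (m≤m+n (a + K) i))))
                              (sym (+-assoc a K i))
    where
    a+[K+i]<n : a + (K + i) < n
    a+[K+i]<n = subst (_< n) (+-assoc a K i) (subst (a + K + i <_) (m+[n∸m]≡n a+K≤n) (+-monoʳ-< (a + K) i<r))
  before<a : All (_< a) before
  before<a = applyUpTo⁺₁ f a λ i<a → subst (_< a) (sym (fixed-before i<a)) i<a
  block∈ : All (λ y → a ≤ y × y < a + K) block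
  block∈ = applyUpTo⁺₁ _ K inside
  a+K≤after : All (a + K ≤_) after
  a+K≤after = applyUpTo⁺₁ _ r λ {i} i<r → subst (a + K ≤_) (sym (fixed-after i<r)) (m≤m+n (a + K) i)
  block≡ : block ≡ map (a +_) relative
  block≡ = trans (applyUpTo-cong K (sym ∘ m+[n∸m]≡n ∘ proj₁ ∘ inside)) (sym (map-applyUpTo _ (a +_) K))

module Gluing {K n a : ℕ} (a+K≤n : a + K ≤ n) {B I : ℕ → ℕ}
              (B-perm : IsPermutation K B) (I-perm : IsPermutation (n ∸ K) I) where
  open Block K
  private
    module B = IsPermutation B-perm
    module I = IsPermutation I-perm

  F : ℕ → ℕ
  F = glue a B I

  glue-preserves-inside : ∀ {j} → Inside a j → Inside a (F j)
  glue-preserves-inside j∈ = subst (Inside a) (sym (glue-inside j∈)) (+-inside a (B.bounded (inside-∸ j∈)))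

  glue-preserves-outside : ∀ {j} → Outside a j → Outside a (F j)
  glue-preserves-outside j∉ = subst (Outside a) (sym (glue-outside j∉)) (expand-outside a _)

  glue-isPermutation : IsPermutation n F
  glue-isPermutation = record { bounded = glue-bounded a+K≤n B.bounded I.bounded ; injective = F-injective }
    where
    F-injective : ∀ {i j} → i < n → j < n → F i ≡ F j → i ≡ j
    F-injective {i} {j} i<n j<n eq = cases (inside-or-outside a i) (inside-or-outside a j)
      where
      cases : Inside a i ⊎ Outside a i → Inside a j ⊎ Outside a j → i ≡ j
      cases (inj₁ i∈) (inj₁ j∈) = ∸-cancelʳ-≡ (proj₁ i∈) (proj₁ j∈) (B.injective (inside-∸ i∈) (inside-∸ j∈)
                                    (+-cancelˡ-≡ a _ _ (trans (sym (glue-inside i∈)) (trans eq (glue-inside j∈)))))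
      cases (inj₁ i∈) (inj₂ j∉) = contradiction (subst (Outside a) (sym eq) (glue-preserves-outside j∉))
                                    (inside⇒¬outside (glue-preserves-inside i∈))
      cases (inj₂ i∉) (inj₁ j∈) = contradiction (subst (Outside a) eq (glue-preserves-outside i∉))
                                    (inside⇒¬outside (glue-preserves-inside j∈))
      cases (inj₂ i∉) (inj₂ j∉) = begin
        i                       ≡⟨ expand-collapse i∉ ⟨
        expand a (collapse a i) ≡⟨ cong (expand a) (I.injective (collapse< a+K≤n i<n i∉) (collapse< a+K≤n j<n j∉)
                                     (expand-injective a (trans (sym (glue-outside i∉)) (trans eq (glue-outside j∉))))) ⟩
        expand a (collapse a j) ≡⟨ expand-collapse j∉ ⟩
        j                       ∎
        where open ≡-Reasoning

  glue²-+ : ∀ {i} → i < K → F (F (a + i)) ≡ a + B (B i)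
  glue²-+ i<K = trans (cong F (glue-+ a B I i<K)) (glue-+ a B I (B.bounded i<K))

  module _ (I-involutive : ∀ {v} → v < n ∸ K → I (I v) ≡ v) where

    glue²-outside : ∀ {j} → j < n → Outside a j → F (F j) ≡ j
    glue²-outside {j} j<n j∉ = begin
      F (F j)                          ≡⟨ cong F (glue-outside j∉) ⟩
      F (expand a (I (collapse a j)))  ≡⟨ glue-expand a B I _ ⟩
      expand a (I (I (collapse a j)))  ≡⟨ cong (expand a) (I-involutive (collapse< a+K≤n j<n j∉)) ⟩
      expand a (collapse a j)          ≡⟨ expand-collapse j∉ ⟩
      j                                ∎
      where open ≡-Reasoning

    descents-glue² : descents (applyUpTo (F ∘ F) n) ≡ descents (applyUpTo (B ∘ B) K)
    descents-glue² = trans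
      (descents-block (F ∘ F) a+K≤n glue²-outside
        (λ i<K → subst (Inside a) (sym (glue²-+ i<K)) (+-inside a (B.bounded (B.bounded i<K)))))
      (cong descents (applyUpTo-cong K λ {i} i<K → trans (cong (_∸ a) (glue²-+ i<K)) (m+n∸m≡n a (B (B i)))))

module Ungluing {k n : ℕ} {P : ℕ → ℕ} (P-perm : IsPermutation n P) (S : BlockShape n (suc k) (P ∘ P)) where
  open Block (suc k)
  open IsPermutation P-perm
  open BlockShape S renaming (start to a; start+K≤n to a+K≤n)

  private
    inside<n : ∀ {j} → Inside a j → j < n
    inside<n (_ , j<a+K) = <-≤-trans j<a+K a+K≤n

    -- P commutes with P ∘ P, so it preserves the fixed points of P ∘ P and the moved ones.
    P-preserves-outside : ∀ {j} → j < n → Outside a j → Outside a (P j)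
    P-preserves-outside {j} j<n j∉ with inside-or-outside a (P j)
    ... | inj₂ Pj∉ = Pj∉
    ... | inj₁ Pj∈ = contradiction (cong P (fixed-outside j<n j∉)) (moved-inside Pj∈)

    P-preserves-inside : ∀ {j} → Inside a j → Inside a (P j)
    P-preserves-inside {j} j∈ with inside-or-outside a (P j)
    ... | inj₁ Pj∈ = Pj∈
    ... | inj₂ Pj∉ = contradiction (injective (bounded (bounded j<n)) j<n (fixed-outside (bounded j<n) Pj∉))
                                   (moved-inside j∈)
      where
      j<n : j < n
      j<n = inside<n j∈

    expand<n : ∀ {v} → v < n ∸ suc k → expand a v < n
    expand<n = expand< a (m+n≤o⇒n≤o a a+K≤n)

    P-expand-outside : ∀ {v} → v < n ∸ suc k → Outside a (P (expand a v))
    P-expand-outside {v} v<c = P-preserves-outside (expand<n v<c) (expand-outside a v)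

  B : ℕ → ℕ
  B i = P (a + i) ∸ a

  I : ℕ → ℕ
  I v = collapse a (P (expand a v))

  B-isPermutation : IsPermutation (suc k) B
  B-isPermutation = record
    { bounded   = λ i<K → inside-∸ (P-preserves-inside (+-inside a i<K))
    ; injective = λ i<K j<K → +-cancelˡ-≡ a _ _ ∘ injective (inside<n (+-inside a i<K)) (inside<n (+-inside a j<K))
                    ∘ ∸-cancelʳ-≡ (proj₁ (P-preserves-inside (+-inside a i<K))) (proj₁ (P-preserves-inside (+-inside a j<K)))
    }

  I-isPermutation : IsPermutation (n ∸ suc k) I
  I-isPermutation = record
    { bounded   = λ v<c → collapse< a+K≤n (bounded (expand<n v<c)) (P-expand-outside v<c)
    ; injective = λ {u} {v} u<c v<c eq → expand-injective a (injective (expand<n u<c) (expand<n v<c) (begin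
        P (expand a u)     ≡⟨ expand-collapse (P-expand-outside u<c) ⟨
        expand a (I u)     ≡⟨ cong (expand a) eq ⟩
        expand a (I v)     ≡⟨ expand-collapse (P-expand-outside v<c) ⟩
        P (expand a v)     ∎))
    }
    where open ≡-Reasoning

  I-involutive : ∀ {v} → v < n ∸ suc k → I (I v) ≡ v
  I-involutive {v} v<c = begin
    collapse a (P (expand a (I v)))  ≡⟨ cong (collapse a ∘ P) (expand-collapse (P-expand-outside v<c)) ⟩
    collapse a (P (P (expand a v)))  ≡⟨ cong (collapse a) (fixed-outside (expand<n v<c) (expand-outside a v)) ⟩
    collapse a (expand a v)          ≡⟨ collapse-expand a v ⟩
    v                                ∎
    where open ≡-Reasoning

  glue≗P : ∀ {j} → j < n → glue a B I j ≡ P j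
  glue≗P {j} j<n = [ on-inside , on-outside ]′ (inside-or-outside a j)
    where
    on-inside : Inside a j → glue a B I j ≡ P j
    on-inside j∈ = trans (glue-inside j∈) (trans (cong (λ r → a + (P r ∸ a)) (m+[n∸m]≡n (proj₁ j∈)))
                     (m+[n∸m]≡n (proj₁ (P-preserves-inside j∈))))
    on-outside : Outside a j → glue a B I j ≡ P j
    on-outside j∉ = trans (glue-outside j∉) (trans (cong (expand a ∘ collapse a ∘ P) (expand-collapse j∉))
                      (expand-collapse (P-preserves-outside j<n j∉)))

  descents-B² : descents (applyUpTo (B ∘ B) (suc k)) ≡ descents (applyUpTo (P ∘ P) n)
  descents-B² = begin
    descents (applyUpTo (B ∘ B) (suc k))             ≡⟨ Gluing.descents-glue² a+K≤n B-isPermutation I-isPermutation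
                                                                                 I-involutive ⟨
    descents (applyUpTo (glue a B I ∘ glue a B I) n) ≡⟨ cong descents (applyUpTo-cong n λ j<n →
                                                          trans (cong (glue a B I) (glue≗P j<n)) (glue≗P (bounded j<n))) ⟩
    descents (applyUpTo (P ∘ P) n)                   ∎
    where open ≡-Reasoning

-- Counting permutations whose square has a single descent of size k

descentSizes-square : ∀ {n} (π : OneLine n) {f : ℕ → ℕ} → (∀ {j} → j < n → at π j ≡ f j) →
                      descentSizes (square π) ≡ descents (applyUpTo (f ∘ f) n)
descentSizes-square {n} π {f} π≗f = trans (descentSizes≡descents (square π)) (cong descents (applyUpTo-cong n λ j<n →
  trans (at-square π j<n) (trans (π≗f (at< π j<n)) (cong f (π≗f j<n)))))

squareDescentsOf? : ∀ {n} (k : ℕ) (π : OneLine n) → Dec (descentSizes (square π) ≡ k ∷ [])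
squareDescentsOf? k π = ≡-dec _≟_ (descentSizes (square π)) (k ∷ [])

countSquareDescent : ℕ → ℕ → ℕ
countSquareDescent n k = length (filter (squareDescentsOf? k) (Sym n))

-- π corresponds to (a, β, ι): the block [a, a + k] moved by π², π restricted to it and shifted
-- to start at 0, and the involution π induces on the complement.
module Decomposition (n k : ℕ) (k<n : k < n) where
  open Block (suc k)

  c : ℕ
  c = n ∸ suc k

  Params : Set
  Params = Fin (n ∸ k) × OneLine (suc k) × OneLine c

  roots : List (OneLine (suc k))
  roots = filter (λ β → inA? k (square β)) (Sym (suc k))

  involutions : List (OneLine c)
  involutions = filter isInvolution? (Sym c)

  params : List Params
  params = cartesianProduct (allFin (n ∸ k)) (cartesianProduct roots involutions)

  ValidParams : Params → Set
  ValidParams (_ , β , ι) = IsPerm β × InB k β × IsPerm ι × IsInvolution ι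

  ∈-params⁻ : ∀ {y} → y ∈ params → ValidParams y
  ∈-params⁻ {a , β , ι} y∈ with _ , βι∈ ← ∈-cartesianProduct⁻ (allFin (n ∸ k)) _ y∈
                           with β∈ , ι∈ ← ∈-cartesianProduct⁻ _ _ βι∈
                           with β∈Sym , β²∈A ← ∈-filter⁻ (λ β → inA? k (square β)) {xs = Sym (suc k)} β∈
                           with ι∈Sym , ι²≡id ← ∈-filter⁻ isInvolution? {xs = Sym c} ι∈
    = ∈-Sym⁻ β∈Sym , β²∈A , ∈-Sym⁻ ι∈Sym , ι²≡id

  ∈-params⁺ : ∀ {y} → ValidParams y → y ∈ params
  ∈-params⁺ {a , β , ι} (β-perm , β²∈A , ι-perm , ι²≡id) = ∈-cartesianProduct⁺ (∈-allFin a)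
    (∈-cartesianProduct⁺ (∈-filter⁺ (λ β → inA? k (square β)) (∈-Sym⁺ β-perm) β²∈A)
                         (∈-filter⁺ isInvolution? (∈-Sym⁺ ι-perm) ι²≡id))

  params-unique : Unique params
  params-unique = Unique.cartesianProduct⁺ (Unique.allFin⁺ _)
    (Unique.cartesianProduct⁺ (Unique.filter⁺ _ (Sym-unique _)) (Unique.filter⁺ _ (Sym-unique _)))

  block-fits : ∀ {a} → a < n ∸ k → a + suc k ≤ n
  block-fits {a} a<n∸k = subst (_≤ n) (sym (+-suc a k)) (m≤o∸n⇒m+n≤o (suc a) (<⇒≤ k<n) a<n∸k)

  block-fits⁻ : ∀ {a} → a + suc k ≤ n → a < n ∸ k
  block-fits⁻ {a} a+K≤n = m+n≤o⇒m≤o∸n (suc a) (subst (_≤ n) (+-suc a k) a+K≤n)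

  encodeMap : Params → ℕ → ℕ
  encodeMap (a , β , ι) = glue (toℕ a) (at β) (at ι)

  encode : Params → OneLine n
  encode y@(a , β , ι) = fromFun n (encodeMap y) (glue-bounded (block-fits (toℕ<n a)) (at< β) (at< ι))

  at-encode : ∀ y {j} → j < n → at (encode y) j ≡ encodeMap y j
  at-encode y@(a , β , ι) = at-fromFun n (encodeMap y) _

  module Encoded (a : Fin (n ∸ k)) {β ι} (valid : ValidParams (a , β , ι)) where
    open Gluing (block-fits (toℕ<n a)) (IsPerm⇒IsPermutation (proj₁ valid))
                (IsPerm⇒IsPermutation (proj₁ (proj₂ (proj₂ valid)))) public

    ι-involutive : ∀ {v} → v < c → at ι (at ι v) ≡ v
    ι-involutive = IsInvolution⇒involutive (proj₂ (proj₂ (proj₂ valid)))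

    descents-F² : descents (applyUpTo (F ∘ F) n) ≡ k ∷ []
    descents-F² = begin
      descents (applyUpTo (F ∘ F) n)                    ≡⟨ descents-glue² ι-involutive ⟩
      descents (applyUpTo (at β ∘ at β) (suc k))        ≡⟨ descentSizes-square β (λ _ → refl) ⟨
      descentSizes (square β)                           ≡⟨ proj₁ (proj₂ valid) ⟩
      k ∷ []                                            ∎
      where open ≡-Reasoning

  encode-into : ∀ {y} → y ∈ params → encode y ∈ Sym n × descentSizes (square (encode y)) ≡ k ∷ []
  encode-into {y@(a , β , ι)} y∈ =
      ∈-Sym⁺ (IsPermutation⇒IsPerm (IsPermutation-cong (sym ∘ at-encode y) glue-isPermutation))
    , trans (descentSizes-square (encode y) (at-encode y)) descents-F²
    where open Encoded a (∈-params⁻ y∈)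

  module Decoded {π : OneLine n} (π∈ : π ∈ Sym n) (π²-descents : descentSizes (square π) ≡ k ∷ []) where
    private
      P-perm : IsPermutation n (at π)
      P-perm = IsPerm⇒IsPermutation (∈-Sym⁻ π∈)

      S : BlockShape n (suc k) (at π ∘ at π)
      S = singleDescent⇒BlockShape (IsPermutation-∘ P-perm P-perm)
            (descents≡[k]⇒SingleDescent _ n (trans (sym (descentSizes-square π (λ _ → refl))) π²-descents))

    open BlockShape S using () renaming (start to a; start+K≤n to a+K≤n)
    open Ungluing P-perm S
    open IsPermutation B-isPermutation using () renaming (bounded to B<)
    open IsPermutation I-isPermutation using () renaming (bounded to I<)

    β : OneLine (suc k)
    β = fromFun (suc k) B B<

    ι : OneLine c
    ι = fromFun c I I<

    a<n∸k : a < n ∸ k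
    a<n∸k = block-fits⁻ a+K≤n

    y : Params
    y = fromℕ< a<n∸k , β , ι

    valid : ValidParams y
    valid = IsPermutation⇒IsPerm (IsPermutation-cong (sym ∘ at-fromFun (suc k) B B<) B-isPermutation)
          , trans (descentSizes-square β (at-fromFun (suc k) B B<))
                  (trans descents-B² (trans (sym (descentSizes-square π (λ _ → refl))) π²-descents))
          , IsPermutation⇒IsPerm (IsPermutation-cong (sym ∘ at-fromFun c I I<) I-isPermutation)
          , involutive⇒IsInvolution λ {v} v<c →
              trans (at-fromFun c I I< (at< ι v<c)) (trans (cong I (at-fromFun c I I< v<c)) (I-involutive v<c))

    encode-y : encode y ≡ π
    encode-y = at-ext λ {j} j<n → begin
      at (encode y) j                           ≡⟨ at-encode y j<n ⟩
      glue (toℕ (fromℕ< a<n∸k)) (at β) (at ι) j ≡⟨ cong (λ r → glue r (at β) (at ι) j) (toℕ-fromℕ< a<n∸k) ⟩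
      glue a (at β) (at ι) j                    ≡⟨ glue-cong a+K≤n (at-fromFun (suc k) B B<) (at-fromFun c I I<) j<n ⟩
      glue a B I j                              ≡⟨ glue≗P j<n ⟩
      at π j                                    ∎
      where open ≡-Reasoning

  encode-onto : ∀ {π} → π ∈ Sym n → descentSizes (square π) ≡ k ∷ [] → ∃[ y ] y ∈ params × encode y ≡ π
  encode-onto π∈ π²-descents = y , ∈-params⁺ valid , encode-y
    where open Decoded π∈ π²-descents

  encode-≗ : ∀ y y′ → encode y ≡ encode y′ → ∀ {j} → j < n → encodeMap y j ≡ encodeMap y′ j
  encode-≗ y y′ eq {j} j<n = trans (sym (at-encode y j<n)) (trans (cong (λ π → at π j) eq) (at-encode y′ j<n))

  -- Both starts are the start of the block moved by the common square.
  same-start : ∀ {y y′} → y ∈ params → y′ ∈ params → encode y ≡ encode y′ → proj₁ y ≡ proj₁ y′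
  same-start {y@(a , _ , _)} {y′@(a′ , _ , _)} y∈ y′∈ eq =
    toℕ-injective (trans (sym (BlockShape-start-unique S (E.glue²-outside E.ι-involutive)))
                         (BlockShape-start-unique S fixed-outside′))
    where
    module E  = Encoded a  (∈-params⁻ y∈)
    module E′ = Encoded a′ (∈-params⁻ y′∈)
    S : BlockShape n (suc k) (E.F ∘ E.F)
    S = singleDescent⇒BlockShape (IsPermutation-∘ E.glue-isPermutation E.glue-isPermutation)
          (descents≡[k]⇒SingleDescent _ n E.descents-F²)
    fixed-outside′ : ∀ {j} → j < n → Outside (toℕ a′) j → E.F (E.F j) ≡ j
    fixed-outside′ j<n j∉ = trans (encode-≗ y y′ eq (IsPermutation.bounded E.glue-isPermutation j<n))
      (trans (cong E′.F (encode-≗ y y′ eq j<n)) (E′.glue²-outside E′.ι-involutive j<n j∉))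

  same-block : ∀ a {β β′ ι ι′} → encode (a , β , ι) ≡ encode (a , β′ , ι′) → β ≡ β′ × ι ≡ ι′
  same-block a {β} {β′} {ι} {ι′} eq = at-ext same-β , at-ext same-ι
    where
    open ≡-Reasoning
    s : ℕ
    s = toℕ a
    s+K≤n : s + suc k ≤ n
    s+K≤n = block-fits (toℕ<n a)
    agree : ∀ {j} → j < n → glue s (at β) (at ι) j ≡ glue s (at β′) (at ι′) j
    agree = encode-≗ (a , β , ι) (a , β′ , ι′) eq
    same-β : ∀ {i} → i < suc k → at β i ≡ at β′ i
    same-β {i} i<K = +-cancelˡ-≡ s _ _ (begin
      s + at β i                     ≡⟨ glue-+ s (at β) (at ι) i<K ⟨
      glue s (at β) (at ι) (s + i)   ≡⟨ agree (<-≤-trans (+-monoʳ-< s i<K) s+K≤n) ⟩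
      glue s (at β′) (at ι′) (s + i) ≡⟨ glue-+ s (at β′) (at ι′) i<K ⟩
      s + at β′ i                    ∎)
    same-ι : ∀ {v} → v < c → at ι v ≡ at ι′ v
    same-ι {v} v<c = expand-injective s (begin
      expand s (at ι v)                   ≡⟨ glue-expand s (at β) (at ι) v ⟨
      glue s (at β) (at ι) (expand s v)   ≡⟨ agree (expand< s (m+n≤o⇒n≤o s s+K≤n) v<c) ⟩
      glue s (at β′) (at ι′) (expand s v) ≡⟨ glue-expand s (at β′) (at ι′) v ⟩
      expand s (at ι′ v)                  ∎)

  encode-injective : ∀ {y y′} → y ∈ params → y′ ∈ params → encode y ≡ encode y′ → y ≡ y′
  encode-injective {a , β , ι} {a′ , β′ , ι′} y∈ y′∈ eq =
    cong₂ _,_ a≡a′ (cong₂ _,_ (proj₁ same) (proj₂ same))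
    where
    a≡a′ : a ≡ a′
    a≡a′ = same-start y∈ y′∈ eq
    same : β ≡ β′ × ι ≡ ι′
    same = same-block a (trans eq (cong (λ r → encode (r , β′ , ι′)) (sym a≡a′)))

  countSquareDescent≡ : countSquareDescent n k ≡ b k * e (n ∸ (k + 1)) * (n ∸ k)
  countSquareDescent≡ = begin
    countSquareDescent n k
      ≡⟨ length-filter≡length (squareDescentsOf? k) encode params-unique (Sym-unique n)
                              encode-into encode-onto encode-injective ⟩
    length params
      ≡⟨ length-cartesianProduct (allFin (n ∸ k)) (cartesianProduct roots involutions) ⟩
    length (allFin (n ∸ k)) * length (cartesianProduct roots involutions)
      ≡⟨ cong₂ _*_ (length-tabulate {n = n ∸ k} (λ i → i)) (length-cartesianProduct roots involutions) ⟩
    (n ∸ k) * (b k * e (n ∸ suc k))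
      ≡⟨ *-comm (n ∸ k) _ ⟩
    b k * e (n ∸ suc k) * (n ∸ k)
      ≡⟨ cong (λ m → b k * e (n ∸ m) * (n ∸ k)) (+-comm 1 k) ⟩
    b k * e (n ∸ (k + 1)) * (n ∸ k)
      ∎
    where open ≡-Reasoning

-- Summing over the descent size

indicator : ∀ {P : Set} → Dec P → ℕ
indicator (yes _) = 1
indicator (no  _) = 0

indicator-yes : ∀ {P : Set} (P? : Dec P) → P → indicator P? ≡ 1
indicator-yes (yes _) _  = refl
indicator-yes (no ¬p) p  = contradiction p ¬p

indicator-no : ∀ {P : Set} (P? : Dec P) → ¬ P → indicator P? ≡ 0
indicator-no (yes p) ¬p = contradiction p ¬p
indicator-no (no  _) _  = refl

length-filter-∷ : ∀ {A : Set} {P : Pred A 0ℓ} (P? : Decidable P) x xs →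
                  length (filter P? (x ∷ xs)) ≡ indicator (P? x) + length (filter P? xs)
length-filter-∷ P? x xs with P? x
... | yes _ = refl
... | no  _ = refl

sum-applyUpTo-+ : ∀ (f g : ℕ → ℕ) m →
                  sum (applyUpTo (λ i → f i + g i) m) ≡ sum (applyUpTo f m) + sum (applyUpTo g m)
sum-applyUpTo-+ f g zero    = refl
sum-applyUpTo-+ f g (suc m) =
  trans (cong (f 0 + g 0 +_) (sum-applyUpTo-+ (f ∘ suc) (g ∘ suc) m)) (interchange (f 0) (g 0) _ _)

sum-applyUpTo-zero : ∀ f m → (∀ {i} → i < m → f i ≡ 0) → sum (applyUpTo f m) ≡ 0
sum-applyUpTo-zero f zero    _   = refl
sum-applyUpTo-zero f (suc m) f≡0 = cong₂ _+_ (f≡0 z<s) (sum-applyUpTo-zero (f ∘ suc) m (f≡0 ∘ s<s))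

sum-applyUpTo-point : ∀ f m {t} → t < m → (∀ {i} → i < m → i ≢ t → f i ≡ 0) → sum (applyUpTo f m) ≡ f t
sum-applyUpTo-point f (suc m) {zero}  _       f≡0 =
  trans (cong (f 0 +_) (sum-applyUpTo-zero (f ∘ suc) m λ i<m → f≡0 (s<s i<m) λ ())) (+-identityʳ (f 0))
sum-applyUpTo-point f (suc m) {suc t} t+1<m+1 f≡0 =
  cong₂ _+_ (f≡0 z<s λ ())
            (sum-applyUpTo-point (f ∘ suc) m (s<s⁻¹ t+1<m+1) λ i<m i≢t → f≡0 (s<s i<m) (i≢t ∘ suc-injective))

length-filter-partition : ∀ {A : Set} {P : Pred A 0ℓ} {Q : ℕ → Pred A 0ℓ}
  (P? : Decidable P) (Q? : ∀ i → Decidable (Q i)) m →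
  (∀ x → indicator (P? x) ≡ sum (applyUpTo (λ i → indicator (Q? i x)) m)) →
  ∀ xs → length (filter P? xs) ≡ sum (applyUpTo (λ i → length (filter (Q? i) xs)) m)
length-filter-partition P? Q? m split []       = sym (sum-applyUpTo-zero _ m λ _ → refl)
length-filter-partition P? Q? m split (x ∷ xs) = begin
  length (filter P? (x ∷ xs))
    ≡⟨ length-filter-∷ P? x xs ⟩
  indicator (P? x) + length (filter P? xs)
    ≡⟨ cong₂ _+_ (split x) (length-filter-partition P? Q? m split xs) ⟩
  sum (applyUpTo (λ i → indicator (Q? i x)) m) + sum (applyUpTo (λ i → length (filter (Q? i) xs)) m)
    ≡⟨ sum-applyUpTo-+ _ _ m ⟨
  sum (applyUpTo (λ i → indicator (Q? i x) + length (filter (Q? i) xs)) m)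
    ≡⟨ cong sum (applyUpTo-cong m λ {i} _ → length-filter-∷ (Q? i) x xs) ⟨
  sum (applyUpTo (λ i → length (filter (Q? i) (x ∷ xs))) m)
    ∎
  where open ≡-Reasoning

indicator-length≡1 : ∀ {n} (ds : List ℕ) → All (λ d → 0 < d × d < n) ds →
  indicator (length ds ≟ 1) ≡ sum (applyUpTo (λ i → indicator (≡-dec _≟_ ds (suc i ∷ []))) (n ∸ 1))
indicator-length≡1 {n} []            _ = sym (sum-applyUpTo-zero _ (n ∸ 1) λ _ → refl)
indicator-length≡1 {n} (_ ∷ _ ∷ _)   _ = sym (sum-applyUpTo-zero _ (n ∸ 1) λ _ → indicator-no (≡-dec _≟_ _ _) λ ())
indicator-length≡1 {n} (d ∷ []) ((0<d , d<n) ∷ []) = sym (begin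
  sum (applyUpTo (λ i → indicator (≡-dec _≟_ (d ∷ []) (suc i ∷ []))) (n ∸ 1))
    ≡⟨ sum-applyUpTo-point _ (n ∸ 1) (∸-monoˡ-< d<n 0<d) (λ _ i≢d∸1 → indicator-no (≡-dec _≟_ _ _)
         (i≢d∸1 ∘ sym ∘ cong pred ∘ trans 1+[d∸1]≡d ∘ ∷-injectiveˡ)) ⟩
  indicator (≡-dec _≟_ (d ∷ []) (suc (d ∸ 1) ∷ []))
    ≡⟨ indicator-yes (≡-dec _≟_ _ _) (cong (_∷ []) (sym 1+[d∸1]≡d)) ⟩
  1 ∎)
  where
  open ≡-Reasoning
  1+[d∸1]≡d : suc (d ∸ 1) ≡ d
  1+[d∸1]≡d = m+[n∸m]≡n 0<d

countOneDescentSquare-by-size : ∀ n →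
  countOneDescentSquare n ≡ sum (applyUpTo (λ i → countSquareDescent n (suc i)) (n ∸ 1))
countOneDescentSquare-by-size n =
  length-filter-partition oneDescentSquare? (λ i → squareDescentsOf? (suc i)) (n ∸ 1)
    (λ π → indicator-length≡1 (descentSizes (square π)) (descentSizes-bounded (square π))) (Sym n)

-- The square of a permutation of [2] is the identity.
b1≡0 : b 1 ≡ 0
b1≡0 = refl

corollary4p8 : (n : ℕ) → n ≥ 3 →
    countOneDescentSquare n
      ≡ sumRange 2 (n ∸ 1) (λ k → b k * e (n ∸ (k + 1)) * (n ∸ k))
corollary4p8 0                       ()
corollary4p8 1                       (s≤s ())
corollary4p8 2                       (s≤s (s≤s ()))
corollary4p8 n@(suc (suc (suc m))) _ = begin
  countOneDescentSquare n
    ≡⟨ countOneDescentSquare-by-size n ⟩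
  countSquareDescent n 1 + sum (applyUpTo (λ i → countSquareDescent n (2 + i)) (suc m))
    ≡⟨ cong₂ _+_ (Decomposition.countSquareDescent≡ n 1 (s≤s (s≤s z≤n)))
                 (cong sum (applyUpTo-cong (suc m) λ {i} i<m+1 →
                   Decomposition.countSquareDescent≡ n (2 + i) (s≤s (s≤s i<m+1)))) ⟩
  summand 1 + sumRange 2 (n ∸ 1) summand
    ≡⟨ cong (λ b₁ → b₁ * e (n ∸ 2) * (n ∸ 1) + sumRange 2 (n ∸ 1) summand) b1≡0 ⟩
  sumRange 2 (n ∸ 1) summand
    ∎
  where
  open ≡-Reasoning
  summand : ℕ → ℕ
  summand k = b k * e (n ∸ (k + 1)) * (n ∸ k)
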